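{- Let $G$ be a connected bipartite graph. Then $\Gamma_{pr}(G)=2\Gamma(G)$ if and only if $G$ is isomorphic to $K_2$.
   Context: All graphs are finite, simple and undirected. A set $D\subseteq V(G)$ is dominating if every vertex is in $D$ or adjacent to a vertex of $D$; it is minimal if no proper subset is dominating. $\Gamma(G)$ is the maximum cardinality of a minimal dominating set of $G$. A paired dominating set (PDS) is a dominating set $D$ such that $G[D]$ has a perfect matching; a PDS is minimal if no proper subset is a PDS. $\Gamma_{pr}(G)$ is the maximum cardinality of a minimal PDS. -}

module Defs where

open import Data.Nat using (ℕ; _≤_; _*_; suc)
open import Data.Bool using (Bool; true; false)
open import Data.Fin using (Fin; zero; suc)
open import Data.Fin.Subset using (Subset; _∈_; _⊂_; ∣_∣)
open import Data.Product using (Σ; ∃; _×_; _,_)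
open import Data.Sum using (_⊎_)
open import Relation.Nullary using (¬_)
open import Relation.Binary.PropositionalEquality using (_≡_; _≢_)
open import Function.Bundles using (_↔_; Inverse)

record Graph : Set where
  field
    n     : ℕ
    adj   : Fin n → Fin n → Bool
    sym   : ∀ u v → adj u v ≡ adj v u
    irrefl : ∀ v → adj v v ≡ false

open Graph public

Adj : (G : Graph) → Fin (n G) → Fin (n G) → Set
Adj G u v = adj G u v ≡ true

data Walk (G : Graph) : Fin (n G) → Fin (n G) → Set where
  here : ∀ {v} → Walk G v v
  step : ∀ {u w v} → Adj G u w → Walk G w v → Walk G u v

Connected : Graph → Set
Connected G = (1 ≤ n G) × (∀ u v → Walk G u v)

Bipartite : Graph → Set
Bipartite G = Σ (Fin (n G) → Bool) λ c → ∀ u v → Adj G u v → c u ≢ c v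

Isomorphic : Graph → Graph → Set
Isomorphic G H = Σ (Fin (n G) ↔ Fin (n H)) λ f →
  ∀ u v → adj G u v ≡ adj H (Inverse.to f u) (Inverse.to f v)

K2adj : Fin 2 → Fin 2 → Bool
K2adj zero zero = false
K2adj zero (suc zero) = true
K2adj (suc zero) zero = true
K2adj (suc zero) (suc zero) = false

K2sym : ∀ u v → K2adj u v ≡ K2adj v u
K2sym zero zero = _≡_.refl
K2sym zero (suc zero) = _≡_.refl
K2sym (suc zero) zero = _≡_.refl
K2sym (suc zero) (suc zero) = _≡_.refl

K2irr : ∀ v → K2adj v v ≡ false
K2irr zero = _≡_.refl
K2irr (suc zero) = _≡_.refl

K₂ : Graph
K₂ = record { n = 2 ; adj = K2adj ; sym = K2sym ; irrefl = K2irr }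

Dominating : (G : Graph) → Subset (n G) → Set
Dominating G D = ∀ v → v ∈ D ⊎ (∃ λ u → u ∈ D × Adj G u v)

MinimalDominating : (G : Graph) → Subset (n G) → Set
MinimalDominating G D = Dominating G D × (∀ D′ → D′ ⊂ D → ¬ Dominating G D′)

-- Perfect matching of the induced subgraph G[D], given by a partner map:
-- every vertex of D is matched to an adjacent vertex of D, and matching is an
-- involution on D (a vertex's partner's partner is itself).
HasPerfectMatching : (G : Graph) → Subset (n G) → Set
HasPerfectMatching G D = Σ (Fin (n G) → Fin (n G)) λ m →
  ∀ v → v ∈ D → (m v ∈ D) × Adj G v (m v) × (m (m v) ≡ v)

PairedDominating : (G : Graph) → Subset (n G) → Set
PairedDominating G D = Dominating G D × HasPerfectMatching G D

MinimalPairedDominating : (G : Graph) → Subset (n G) → Set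
MinimalPairedDominating G D =
  PairedDominating G D × (∀ D′ → D′ ⊂ D → ¬ PairedDominating G D′)

IsUpperDomination : (G : Graph) → ℕ → Set
IsUpperDomination G k =
  (∃ λ D → MinimalDominating G D × ∣ D ∣ ≡ k) ×
  (∀ D → MinimalDominating G D → ∣ D ∣ ≤ k)

IsUpperPairedDomination : (G : Graph) → ℕ → Set
IsUpperPairedDomination G k =
  (∃ λ D → MinimalPairedDominating G D × ∣ D ∣ ≡ k) ×
  (∀ D → MinimalPairedDominating G D → ∣ D ∣ ≤ k)

-- The two colour classes of a bipartite graph without isolated vertices are
-- both minimal dominating sets, so n ≤ 2Γ. Hence if Γpr = 2Γ, a largest minimal
-- paired dominating set is the whole vertex set, carrying a perfect matching m
-- of G. An edge ab with b ≠ m a would let us pair a with b instead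
-- and drop m a and m b, a smaller paired dominating set; so every edge is a
-- matching edge, and connectivity leaves a single edge: G ≅ K₂. Conversely in
-- K₂ the minimal dominating sets are the singletons and the only paired
-- dominating set is the whole graph.
module Submission where

open import Defs
open import Data.Nat using (ℕ; _*_; _+_; _≤_; s≤s)
open import Data.Nat.Properties
  using (≤-antisym; +-mono-≤; +-identityʳ; m+[n∸m]≡n; ≤∧≢⇒<)
open import Data.Bool using (Bool; true)
open import Data.Bool.Properties using (¬-not)
open import Data.Fin using (Fin; zero; suc; _≟_; fromℕ<)
open import Data.Fin.Permutation using (↔⇒≡)
open import Data.Fin.Subset using (Subset; _∈_; _∉_; _⊆_; _⊂_; ∣_∣; ⊤; ∁; _∪_; ⁅_⁆; Nonempty)
open import Data.Fin.Subset.Properties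
  using ( ∈⊤; ⊆⊤; ⊆-antisym; ∣⊤∣≡n; ∣p∣≤n; ∣p∣≡n⇒p≡⊤; ∣∁p∣≡n∸∣p∣; p⊆q⇒∣p∣≤∣q∣
        ; x∈⁅x⁆; x∈⁅y⁆⇒x≡y; ∣⁅x⁆∣≡1; x∈∁p⇒x∉p; x∉p⇒x∈∁p; x∉∁p⇒x∈p; x∈p∪q⁺; x∈p∪q⁻; _∈?_ )
open import Data.Vec using (tabulate)
open import Data.Vec.Properties using (lookup∘tabulate; []=⇒lookup; lookup⇒[]=)
open import Data.Product using (∃; ∃₂; _×_; _,_; proj₁; proj₂)
open import Data.Sum using (_⊎_; inj₁; inj₂; [_,_]′)
open import Data.Empty using (⊥-elim)
open import Function using (_∘_)
open import Function.Bundles using (Inverse; mk↔ₛ′)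
open import Relation.Nullary using (¬_; Dec; yes; no)
open import Relation.Binary.PropositionalEquality
  using (_≡_; _≢_; refl; trans; cong; subst; subst₂; module ≡-Reasoning) renaming (sym to ≡-sym)

∈tabulate⁺ : ∀ {k} (f : Fin k → Bool) {v} → f v ≡ true → v ∈ tabulate f
∈tabulate⁺ f {v} fv = lookup⇒[]= v _ (trans (lookup∘tabulate f v) fv)

∈tabulate⁻ : ∀ {k} (f : Fin k → Bool) {v} → v ∈ tabulate f → f v ≡ true
∈tabulate⁻ f {v} v∈ = trans (≡-sym (lookup∘tabulate f v)) ([]=⇒lookup v∈)

∣p∣+∣∁p∣≡n : ∀ {k} (p : Subset k) → ∣ p ∣ + ∣ ∁ p ∣ ≡ k
∣p∣+∣∁p∣≡n p = trans (cong (∣ p ∣ +_) (∣∁p∣≡n∸∣p∣ p)) (m+[n∸m]≡n (∣p∣≤n p))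

nonempty⇒1≤∣p∣ : ∀ {k} {p : Subset k} → Nonempty p → 1 ≤ ∣ p ∣
nonempty⇒1≤∣p∣ {p = p} (x , x∈p) =
  subst (_≤ ∣ p ∣) (∣⁅x⁆∣≡1 x) (p⊆q⇒∣p∣≤∣q∣ ⁅x⁆⊆p)
  where
  ⁅x⁆⊆p : ⁅ x ⁆ ⊆ p
  ⁅x⁆⊆p y∈⁅x⁆ = subst (_∈ p) (≡-sym (x∈⁅y⁆⇒x≡y x y∈⁅x⁆)) x∈p

∈∁⁅x⁆∪⁅y⁆⁺ : ∀ {k} {x y v : Fin k} → v ≢ x → v ≢ y → v ∈ ∁ (⁅ x ⁆ ∪ ⁅ y ⁆)
∈∁⁅x⁆∪⁅y⁆⁺ {x = x} {y} v≢x v≢y =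
  x∉p⇒x∈∁p ([ v≢x ∘ x∈⁅y⁆⇒x≡y x , v≢y ∘ x∈⁅y⁆⇒x≡y y ]′ ∘ x∈p∪q⁻ ⁅ x ⁆ ⁅ y ⁆)

∈∁⁅x⁆∪⁅y⁆⁻ : ∀ {k} {x y v : Fin k} → v ∈ ∁ (⁅ x ⁆ ∪ ⁅ y ⁆) → v ≢ x × v ≢ y
∈∁⁅x⁆∪⁅y⁆⁻ v∈ =
  (λ { refl → x∈∁p⇒x∉p v∈ (x∈p∪q⁺ (inj₁ (x∈⁅x⁆ _))) }) ,
  (λ { refl → x∈∁p⇒x∉p v∈ (x∈p∪q⁺ (inj₂ (x∈⁅x⁆ _))) })

module _ (G : Graph) where

  NoIsolatedVertex : Set
  NoIsolatedVertex = ∀ v → ∃ λ u → Adj G u v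

  Independent : Subset (n G) → Set
  Independent S = ∀ {u v} → Adj G u v → u ∈ S → v ∉ S

  VertexCover : Subset (n G) → Set
  VertexCover S = ∀ {u v} → Adj G u v → u ∉ S → v ∈ S

  PerfectMatching : (Fin (n G) → Fin (n G)) → Set
  PerfectMatching m = ∀ v → Adj G v (m v) × m (m v) ≡ v

  adj-sym : ∀ {u v} → Adj G u v → Adj G v u
  adj-sym {u} {v} uv = trans (sym G v u) uv

  adj⇒≢ : ∀ {u v} → Adj G u v → u ≢ v
  adj⇒≢ {u} uv refl with trans (≡-sym uv) (irrefl G u)
  ... | ()

  connected∧edge⇒noIsolatedVertex : (∀ u v → Walk G u v) →
    ∀ {x y} → Adj G x y → NoIsolatedVertex
  connected∧edge⇒noIsolatedVertex walk {x} {y} xy v with walk v x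
  ... | here              = y , adj-sym xy
  ... | step {w = w} vw _ = w , adj-sym vw

  dominating⇒nonempty : ∀ {D} → Fin (n G) → Dominating G D → Nonempty D
  dominating⇒nonempty v dom with dom v
  ... | inj₁ v∈D           = v , v∈D
  ... | inj₂ (u , u∈D , _) = u , u∈D

  independent∧dominating⇒minimal : ∀ {S} → Independent S → Dominating G S →
    MinimalDominating G S
  independent∧dominating⇒minimal indep dom = dom , minimal
    where
    minimal : ∀ D′ → D′ ⊂ _ → ¬ Dominating G D′
    minimal D′ (D′⊆S , x , x∈S , x∉D′) dom′ with dom′ x
    ... | inj₁ x∈D′            = x∉D′ x∈D′
    ... | inj₂ (u , u∈D′ , ux) = indep ux (D′⊆S u∈D′) x∈S

  vertexCover⇒dominating : NoIsolatedVertex → ∀ {S} → VertexCover S → Dominating G S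
  vertexCover⇒dominating noIso {S} cover v with v ∈? S
  ... | yes v∈S = inj₁ v∈S
  ... | no v∉S  = let u , uv = noIso v in inj₂ (u , cover (adj-sym uv) v∉S , uv)

  ∁-independent : ∀ {S} → VertexCover S → Independent (∁ S)
  ∁-independent cover uv u∈∁S v∈∁S = x∈∁p⇒x∉p v∈∁S (cover uv (x∈∁p⇒x∉p u∈∁S))

  ∁-vertexCover : ∀ {S} → Independent S → VertexCover (∁ S)
  ∁-vertexCover indep uv u∉∁S = x∉p⇒x∈∁p (indep uv (x∉∁p⇒x∈p u∉∁S))

  independentVertexCover⇒minimalDominating : NoIsolatedVertex → ∀ {S} →
    Independent S → VertexCover S → MinimalDominating G S
  independentVertexCover⇒minimalDominating noIso indep cover =
    independent∧dominating⇒minimal indep (vertexCover⇒dominating noIso cover)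

  bipartite⇒independentVertexCover : Bipartite G →
    ∃ λ S → Independent S × VertexCover S
  bipartite⇒independentVertexCover (c , proper) = tabulate c , indep , cover
    where
    indep : Independent (tabulate c)
    indep {u} {v} uv u∈ v∈ =
      proper u v uv (trans (∈tabulate⁻ c u∈) (≡-sym (∈tabulate⁻ c v∈)))
    cover : VertexCover (tabulate c)
    cover {u} {v} uv u∉ = ∈tabulate⁺ c (¬-not λ cv≡false →
      proper u v uv (trans (¬-not (u∉ ∘ ∈tabulate⁺ c)) (≡-sym cv≡false)))

  independentVertexCover⇒order≤2Γ : NoIsolatedVertex → ∀ {S} →
    Independent S → VertexCover S → ∀ {γ} → IsUpperDomination G γ → n G ≤ 2 * γ
  independentVertexCover⇒order≤2Γ noIso {S} indep cover {γ} (_ , maximal) =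
    subst₂ _≤_ (∣p∣+∣∁p∣≡n S) (cong (γ +_) (≡-sym (+-identityʳ γ)))
      (+-mono-≤ (maximal S (minimal indep cover))
                (maximal (∁ S) (minimal (∁-independent cover) (∁-vertexCover indep))))
    where
    minimal : ∀ {T} → Independent T → VertexCover T → MinimalDominating G T
    minimal = independentVertexCover⇒minimalDominating noIso

  walk-stays-in-matched-pair : ∀ {m} → PerfectMatching m →
    (∀ {a b} → Adj G a b → b ≡ m a) → ∀ {u v} → Walk G u v → v ≡ u ⊎ v ≡ m u
  walk-stays-in-matched-pair pm matched here = inj₁ refl
  walk-stays-in-matched-pair {m} pm matched {u} (step uw rest)
    with walk-stays-in-matched-pair pm matched rest
  ... | inj₁ v≡w = inj₂ (trans v≡w (matched uw))
  ... | inj₂ v≡mw = inj₁ (trans v≡mw (trans (cong m (matched uw)) (proj₂ (pm u))))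

  spanningEdge⇒≅K₂ : ∀ {x y} → Adj G x y → (∀ v → v ≡ x ⊎ v ≡ y) → Isomorphic G K₂
  spanningEdge⇒≅K₂ {x} {y} xy cover = mk↔ₛ′ to from to∘from from∘to , adj-preserved
    where
    to : Fin (n G) → Fin 2
    to v with v ≟ x
    ... | yes _ = zero
    ... | no _  = suc zero

    from : Fin 2 → Fin (n G)
    from zero       = x
    from (suc zero) = y

    to-x : to x ≡ zero
    to-x with x ≟ x
    ... | yes _  = refl
    ... | no x≢x = ⊥-elim (x≢x refl)

    to-y : to y ≡ suc zero
    to-y with y ≟ x
    ... | yes y≡x = ⊥-elim (adj⇒≢ xy (≡-sym y≡x))
    ... | no _    = refl

    to∘from : ∀ i → to (from i) ≡ i
    to∘from zero       = to-x
    to∘from (suc zero) = to-y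

    from∘to : ∀ v → from (to v) ≡ v
    from∘to v with cover v
    ... | inj₁ refl rewrite to-x = refl
    ... | inj₂ refl rewrite to-y = refl

    adj-preserved : ∀ u v → adj G u v ≡ K2adj (to u) (to v)
    adj-preserved u v with cover u | cover v
    ... | inj₁ refl | inj₁ refl rewrite to-x        = irrefl G x
    ... | inj₁ refl | inj₂ refl rewrite to-x | to-y = xy
    ... | inj₂ refl | inj₁ refl rewrite to-x | to-y = adj-sym xy
    ... | inj₂ refl | inj₂ refl rewrite to-y        = irrefl G y

  ≅K₂⇒spanningEdge : Isomorphic G K₂ → ∃₂ λ x y → Adj G x y × (∀ v → v ≡ x ⊎ v ≡ y)
  ≅K₂⇒spanningEdge (f , adj-preserved) = from zero , from (suc zero) , xy , cover
    where
    open Inverse f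
    xy : Adj G (from zero) (from (suc zero))
    xy rewrite adj-preserved (from zero) (from (suc zero))
             | strictlyInverseˡ zero | strictlyInverseˡ (suc zero) = refl
    cover : ∀ v → v ≡ from zero ⊎ v ≡ from (suc zero)
    cover v with to v in to-v
    ... | zero     = inj₁ (trans (≡-sym (strictlyInverseʳ v)) (cong from to-v))
    ... | suc zero = inj₂ (trans (≡-sym (strictlyInverseʳ v)) (cong from to-v))

module Rematch (G : Graph) {m : Fin (n G) → Fin (n G)} (pm : PerfectMatching G m)
               {a b : Fin (n G)} (ab : Adj G a b) (b≢ma : b ≢ m a) where

  m-swap : ∀ {u v} → m u ≡ v → u ≡ m v
  m-swap {u} mu≡v = trans (≡-sym (proj₂ (pm u))) (cong m mu≡v)

  m-injective : ∀ {u v} → m u ≡ m v → u ≡ v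
  m-injective {v = v} mu≡mv = trans (m-swap mu≡mv) (proj₂ (pm v))

  a≢b : a ≢ b
  a≢b = adj⇒≢ G ab

  a≢ma : a ≢ m a
  a≢ma = adj⇒≢ G (proj₁ (pm a))

  a≢mb : a ≢ m b
  a≢mb = b≢ma ∘ m-swap ∘ ≡-sym

  b≢mb : b ≢ m b
  b≢mb = adj⇒≢ G (proj₁ (pm b))

  D′ : Subset (n G)
  D′ = ∁ (⁅ m a ⁆ ∪ ⁅ m b ⁆)

  a∈D′ : a ∈ D′
  a∈D′ = ∈∁⁅x⁆∪⁅y⁆⁺ a≢ma a≢mb

  b∈D′ : b ∈ D′
  b∈D′ = ∈∁⁅x⁆∪⁅y⁆⁺ b≢ma b≢mb

  D′⊂⊤ : D′ ⊂ ⊤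
  D′⊂⊤ = ⊆⊤ , m a , ∈⊤ , λ ma∈D′ → proj₁ (∈∁⁅x⁆∪⁅y⁆⁻ ma∈D′) refl

  D′-dominating : Dominating G D′
  D′-dominating v with v ≟ m a | v ≟ m b
  ... | yes refl | _        = inj₂ (a , a∈D′ , proj₁ (pm a))
  ... | no _     | yes refl = inj₂ (b , b∈D′ , proj₁ (pm b))
  ... | no v≢ma  | no v≢mb  = inj₁ (∈∁⁅x⁆∪⁅y⁆⁺ v≢ma v≢mb)

  m′ : Fin (n G) → Fin (n G)
  m′ v with v ≟ a | v ≟ b
  ... | yes _ | _     = b
  ... | no _  | yes _ = a
  ... | no _  | no _  = m v

  m′-a : m′ a ≡ b
  m′-a with a ≟ a
  ... | yes _  = refl
  ... | no a≢a = ⊥-elim (a≢a refl)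

  m′-b : m′ b ≡ a
  m′-b with b ≟ a | b ≟ b
  ... | yes b≡a | _      = ⊥-elim (a≢b (≡-sym b≡a))
  ... | no _    | yes _  = refl
  ... | no _    | no b≢b = ⊥-elim (b≢b refl)

  m′-other : ∀ {v} → v ≢ a → v ≢ b → m′ v ≡ m v
  m′-other {v} v≢a v≢b with v ≟ a | v ≟ b
  ... | yes v≡a | _       = ⊥-elim (v≢a v≡a)
  ... | no _    | yes v≡b = ⊥-elim (v≢b v≡b)
  ... | no _    | no _    = refl

  Rematched : Fin (n G) → Set
  Rematched v = m′ v ∈ D′ × Adj G v (m′ v) × m′ (m′ v) ≡ v

  rematched-a : Rematched a
  rematched-a rewrite m′-a | m′-b = b∈D′ , ab , refl

  rematched-b : Rematched b
  rematched-b rewrite m′-b | m′-a = a∈D′ , adj-sym G ab , refl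

  rematched-other : ∀ {v} → v ≢ a → v ≢ b → v ∈ D′ → Rematched v
  rematched-other {v} v≢a v≢b v∈D′ rewrite m′-other v≢a v≢b =
    ∈∁⁅x⁆∪⁅y⁆⁺ (v≢a ∘ m-injective) (v≢b ∘ m-injective) ,
    proj₁ (pm v) ,
    trans (m′-other (v≢ma ∘ m-swap) (v≢mb ∘ m-swap)) (proj₂ (pm v))
    where
    v≢ma : v ≢ m a
    v≢ma = proj₁ (∈∁⁅x⁆∪⁅y⁆⁻ v∈D′)
    v≢mb : v ≢ m b
    v≢mb = proj₂ (∈∁⁅x⁆∪⁅y⁆⁻ v∈D′)

  rematched : ∀ v → v ∈ D′ → Rematched v
  rematched v v∈D′ = by-cases (v ≟ a) (v ≟ b)
    where
    by-cases : Dec (v ≡ a) → Dec (v ≡ b) → Rematched v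
    by-cases (yes v≡a) _         = subst Rematched (≡-sym v≡a) rematched-a
    by-cases (no _)    (yes v≡b) = subst Rematched (≡-sym v≡b) rematched-b
    by-cases (no v≢a)  (no v≢b)  = rematched-other v≢a v≢b v∈D′

  D′-pairedDominating : PairedDominating G D′
  D′-pairedDominating = D′-dominating , m′ , rematched

module _ (G : Graph) where

  minimal⊤⇒edges-matched : ∀ {m} → PerfectMatching G m →
    (∀ D → D ⊂ ⊤ → ¬ PairedDominating G D) → ∀ {a b} → Adj G a b → b ≡ m a
  minimal⊤⇒edges-matched {m} pm minimal {a} {b} ab with b ≟ m a
  ... | yes b≡ma = b≡ma
  ... | no b≢ma  = ⊥-elim (minimal D′ D′⊂⊤ D′-pairedDominating)
    where open Rematch G pm ab b≢ma

  connected∧minimalPDS⊤⇒≅K₂ : Connected G → MinimalPairedDominating G ⊤ → Isomorphic G K₂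
  connected∧minimalPDS⊤⇒≅K₂ (1≤n , walk) ((_ , m , matching) , minimal) =
    spanningEdge⇒≅K₂ G (proj₁ (pm x)) λ v →
      walk-stays-in-matched-pair G pm (minimal⊤⇒edges-matched pm minimal) (walk x v)
    where
    x : Fin (n G)
    x = fromℕ< 1≤n
    pm : PerfectMatching G m
    pm v = proj₂ (matching v ∈⊤)

  bipartite∧Γpr≡2Γ⇒minimalPDS≡⊤ : Connected G → Bipartite G → ∀ {γ D} →
    IsUpperDomination G γ → MinimalPairedDominating G D → ∣ D ∣ ≡ 2 * γ → D ≡ ⊤
  bipartite∧Γpr≡2Γ⇒minimalPDS≡⊤ (1≤n , walk) bip {γ} {D} Γ ((dom , m , matching) , _) ∣D∣≡2γ =
    ∣p∣≡n⇒p≡⊤ (≤-antisym (∣p∣≤n D) (subst (n G ≤_) (≡-sym ∣D∣≡2γ) n≤2γ))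
    where
    noIso : NoIsolatedVertex G
    noIso with dominating⇒nonempty G (fromℕ< 1≤n) dom
    ... | w , w∈D = connected∧edge⇒noIsolatedVertex G walk (proj₁ (proj₂ (matching w w∈D)))
    n≤2γ : n G ≤ 2 * γ
    n≤2γ with bipartite⇒independentVertexCover G bip
    ... | _ , indep , cover = independentVertexCover⇒order≤2Γ G noIso indep cover Γ

  module _ {x y : Fin (n G)} (xy : Adj G x y) (cover : ∀ v → v ≡ x ⊎ v ≡ y) where

    distinct⇒spanning : ∀ {u w} → u ≢ w → ∀ v → v ≡ u ⊎ v ≡ w
    distinct⇒spanning {u} {w} u≢w v with cover u | cover w | cover v
    ... | inj₁ refl | inj₁ refl | _         = ⊥-elim (u≢w refl)
    ... | inj₂ refl | inj₂ refl | _         = ⊥-elim (u≢w refl)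
    ... | inj₁ refl | inj₂ refl | inj₁ refl = inj₁ refl
    ... | inj₁ refl | inj₂ refl | inj₂ refl = inj₂ refl
    ... | inj₂ refl | inj₁ refl | inj₁ refl = inj₂ refl
    ... | inj₂ refl | inj₁ refl | inj₂ refl = inj₁ refl

    spanningEdge∧pairedDominating⇒≡⊤ : ∀ {D} → PairedDominating G D → D ≡ ⊤
    spanningEdge∧pairedDominating⇒≡⊤ {D} (dom , m , matching)
      with dominating⇒nonempty G x dom
    ... | w , w∈D with matching w w∈D
    ...   | mw∈D , w-mw , _ = ⊆-antisym ⊆⊤ λ {v} _ →
      [ (λ v≡w → subst (_∈ D) (≡-sym v≡w) w∈D) , (λ v≡mw → subst (_∈ D) (≡-sym v≡mw) mw∈D) ]′
        (distinct⇒spanning (adj⇒≢ G w-mw) v)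

    spanningEdge⇒singleton-dominating : Dominating G ⁅ x ⁆
    spanningEdge⇒singleton-dominating v with cover v
    ... | inj₁ refl = inj₁ (x∈⁅x⁆ x)
    ... | inj₂ refl = inj₂ (x , x∈⁅x⁆ x , xy)

    spanningEdge∧minimalDominating⇒≢⊤ : ∀ {D} → MinimalDominating G D → D ≢ ⊤
    spanningEdge∧minimalDominating⇒≢⊤ (_ , minimal) refl =
      minimal ⁅ x ⁆ (⊆⊤ , y , ∈⊤ , adj⇒≢ G xy ∘ ≡-sym ∘ x∈⁅y⁆⇒x≡y x)
        spanningEdge⇒singleton-dominating

  ≅K₂⇒pairedDominating-size≡2 : Isomorphic G K₂ → ∀ {D} → PairedDominating G D → ∣ D ∣ ≡ 2
  ≅K₂⇒pairedDominating-size≡2 iso pds with ≅K₂⇒spanningEdge G iso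
  ... | _ , _ , xy , cover rewrite spanningEdge∧pairedDominating⇒≡⊤ xy cover pds =
    trans (∣⊤∣≡n (n G)) (↔⇒≡ (proj₁ iso))

  ≅K₂⇒minimalDominating-size≡1 : Isomorphic G K₂ → ∀ {D} → MinimalDominating G D → ∣ D ∣ ≡ 1
  ≅K₂⇒minimalDominating-size≡1 iso {D} mds with ≅K₂⇒spanningEdge G iso
  ... | x , _ , xy , cover = ≤-antisym ∣D∣≤1 (nonempty⇒1≤∣p∣ (dominating⇒nonempty G x (proj₁ mds)))
    where
    n≡2 : n G ≡ 2
    n≡2 = ↔⇒≡ (proj₁ iso)
    ∣D∣≢2 : ∣ D ∣ ≢ 2
    ∣D∣≢2 ∣D∣≡2 = spanningEdge∧minimalDominating⇒≢⊤ xy cover mds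
      (∣p∣≡n⇒p≡⊤ (trans ∣D∣≡2 (≡-sym n≡2)))
    ∣D∣≤1 : ∣ D ∣ ≤ 1
    ∣D∣≤1 with ≤∧≢⇒< (subst (∣ D ∣ ≤_) n≡2 (∣p∣≤n D)) ∣D∣≢2
    ... | s≤s ∣D∣≤1 = ∣D∣≤1

theorem9 : (G : Graph) → Connected G → Bipartite G →
    (γ γpr : ℕ) → IsUpperDomination G γ → IsUpperPairedDomination G γpr →
      ((γpr ≡ 2 * γ → Isomorphic G K₂) × (Isomorphic G K₂ → γpr ≡ 2 * γ))
theorem9 G conn bip γ γpr Γ ((D , minimalPDS , ∣D∣≡γpr) , _) = forward , backward
  where
  forward : γpr ≡ 2 * γ → Isomorphic G K₂
  forward γpr≡2γ = connected∧minimalPDS⊤⇒≅K₂ G conn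
    (subst (MinimalPairedDominating G)
      (bipartite∧Γpr≡2Γ⇒minimalPDS≡⊤ G conn bip Γ minimalPDS (trans ∣D∣≡γpr γpr≡2γ))
      minimalPDS)

  backward : Isomorphic G K₂ → γpr ≡ 2 * γ
  backward iso with proj₁ Γ
  ... | D₁ , minimalDS , ∣D₁∣≡γ = begin
    γpr        ≡⟨ ≡-sym ∣D∣≡γpr ⟩
    ∣ D ∣      ≡⟨ ≅K₂⇒pairedDominating-size≡2 G iso (proj₁ minimalPDS) ⟩
    2 * 1      ≡⟨ cong (2 *_) (≡-sym (≅K₂⇒minimalDominating-size≡1 G iso minimalDS)) ⟩
    2 * ∣ D₁ ∣ ≡⟨ cong (2 *_) ∣D₁∣≡γ ⟩
    2 * γ      ∎
    where open ≡-Reasoning
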